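{- Let $S_1,\dots,S_h$ be a haplotype panel of $h$ strings of length $m$, with PBWT having $\tilde r$ runs, and for each $c\in[1,h]$ let $L_c$ be the list of haplotype intervals of $S_c$. For every constant integer $d>1$ there exist lists $\mathrm{RS}[1],\dots,\mathrm{RS}[h]$ of integer intervals (called refined segments) such that: (i) each refined segment in $\mathrm{RS}[c]$ is a subinterval of some haplotype interval in $L_c$; (ii) for every $1\le c\le h$, the refined segments in $\mathrm{RS}[c]$ form a partition of $[1,m]$; (iii) each refined segment $[b,e]$ in $\mathrm{RS}[c]$ overlaps (shares at least one integer with) at most $d$ refined segments in $\mathrm{RS}[c']$, where $c'=\phi_e(c)$, whenever $c'>0$; and (iv) the total number of refined segments is at most $\tilde r+h+\left\lceil\frac{\tilde r+h}{d-1}\right\rceil$.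
   Context: A haplotype panel consists of $h$ strings $S_1,\dots,S_h$ (not necessarily distinct), each of length $m$, over a totally ordered alphabet. The prefix array $\mathrm{PA}$ is an $h\times m$ matrix whose column $1$ is $1,\dots,h$ and whose column $j>1$ lists the haplotype indices sorted by the co-lexicographic order of the prefixes $S_1[1..j-1],\dots,S_h[1..j-1]$ (co-lexicographic = lexicographic comparison of the reversed strings; ties broken stably, consistently with column $j-1$). The PBWT is the $h\times m$ matrix with $\mathrm{col}_j(\mathrm{PBWT})[x]=S_{\mathrm{col}_j(\mathrm{PA})[x]}[j]$. A pair $(x,j)$ is a run-top if $x=1$ or $\mathrm{col}_j(\mathrm{PBWT})[x]\ne\mathrm{col}_j(\mathrm{PBWT})[x-1]$; $\tilde r$ is the total number of runs (maximal blocks of equal consecutive symbols in a column) of the PBWT. For $j\in[1,m]$ and $i\in[1,h]$ with $\mathrm{col}_j(\mathrm{PA})[x]=i$, $\phi_j(i)=0$ if $x=1$, else $\phi_j(i)=\mathrm{col}_j(\mathrm{PA})[x-1]$. Haplotype intervals of $S_i$: let $b_1<\dots<b_k=m$ be the sorted set consisting of $m$ together with all columns $j$ for which there is a row $x$ with $(x,j)$ a run-top and $\mathrm{col}_j(\mathrm{PA})[x]=i$; the haplotype intervals of $S_i$ are $[1,b_1],[b_1+1,b_2],\dots,[b_{k-1}+1,b_k]$, forming the list $L_i$ in increasing order. -}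

module Defs where

open import Data.Nat using (ℕ; zero; suc; _+_; _∸_; _≤_; _<ᵇ_; _≡ᵇ_; NonZero)
open import Data.Nat.DivMod using (_/_)
open import Data.Bool using (Bool; true; false; not; _∨_; _∧_; if_then_else_)
open import Data.Fin using (Fin; toℕ)
open import Data.List using (List; []; _∷_; map; filterᵇ; reverse; length; allFin)
open import Data.Nat.ListAction using (sum)
open import Data.List.Relation.Unary.All using (All)
open import Relation.Binary.PropositionalEquality using (_≡_)
open import Data.Maybe using (Maybe; just; nothing)
open import Data.Product using (_×_; _,_; proj₁; proj₂)

-- Positions and columns are 0-indexed as elements of Fin m;
-- the paper's column j (1-indexed) is our column with toℕ = j - 1.
Panel : ℕ → ℕ → Set
Panel h m = Fin h → Fin m → ℕ

-- positions strictly below column j, i.e. the prefix S[1..j-1] in paper terms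
below : {m : ℕ} → Fin m → List (Fin m)
below {m} j = filterᵇ (λ p → toℕ p <ᵇ toℕ j) (allFin m)

firstDiff : {m : ℕ} → (Fin m → ℕ) → (Fin m → ℕ) → List (Fin m) → Maybe (Fin m)
firstDiff a b [] = nothing
firstDiff a b (p ∷ ps) = if a p ≡ᵇ b p then firstDiff a b ps else just p

-- haplotype x comes before haplotype y in column j of the prefix array:
-- co-lexicographic order of the prefixes of length j (compare from the last
-- position backwards), ties broken by haplotype index (the stable order).
colexBefore : {h m : ℕ} → Panel h m → Fin m → Fin h → Fin h → Bool
colexBefore S j x y with firstDiff (S x) (S y) (reverse (below j))
... | just p  = S x p <ᵇ S y p
... | nothing = toℕ x <ᵇ toℕ y

-- row (0-indexed) of haplotype i in column j of the prefix array
rank : {h m : ℕ} → Panel h m → Fin m → Fin h → ℕ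
rank {h} S j i = length (filterᵇ (λ i' → colexBefore S j i' i) (allFin h))

findFirst : {A : Set} → (A → Bool) → List A → Maybe A
findFirst p [] = nothing
findFirst p (x ∷ xs) = if p x then just x else findFirst p xs

-- col_j(PA)[x] (0-indexed row x); always 'just' for x < h
PA : {h m : ℕ} → Panel h m → Fin m → ℕ → Maybe (Fin h)
PA {h} S j x = findFirst (λ i → rank S j i ≡ᵇ x) (allFin h)

-- φ_j(i): the haplotype in the row just above i in column j of PA;
-- 'nothing' plays the role of the value 0 (i is in the first row).
φ : {h m : ℕ} → Panel h m → Fin m → Fin h → Maybe (Fin h)
φ S j i with rank S j i
... | zero  = nothing
... | suc x = PA S j x

-- the row of haplotype i in column j is a run-top of the PBWT
-- (first row, or PBWT symbol differs from the one in the row above)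
runTop : {h m : ℕ} → Panel h m → Fin m → Fin h → Bool
runTop S j i with φ S j i
... | nothing = true
... | just i' = not (S i' j ≡ᵇ S i j)

-- r̃: total number of runs of the PBWT = total number of run-tops
-- (counted over haplotypes, which are in bijection with rows via rank)
runs : {h m : ℕ} → Panel h m → ℕ
runs {h} {m} S = sum (map (λ j → length (filterᵇ (runTop S j) (allFin h))) (allFin m))

-- Integer intervals [b, e], as pairs (b , e), 1-indexed as in the paper
Interval : Set
Interval = ℕ × ℕ

-- sorted breakpoint columns (1-indexed) b_1 < ... < b_k = m of haplotype i
breakCols : {h m : ℕ} → Panel h m → Fin h → List ℕ
breakCols {h} {m} S i =
  map (λ j → suc (toℕ j))
      (filterᵇ (λ j → (suc (toℕ j) ≡ᵇ m) ∨ runTop S j i) (allFin m))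

intervalsFrom : ℕ → List ℕ → List Interval
intervalsFrom s [] = []
intervalsFrom s (b ∷ bs) = (s , b) ∷ intervalsFrom (suc b) bs

hapIntervals : {h m : ℕ} → Panel h m → Fin h → List Interval
hapIntervals S i = intervalsFrom 1 (breakCols S i)

_⊆ᵢ_ : Interval → Interval → Set
(b , e) ⊆ᵢ (b' , e') = (b' ≤ b) × (e ≤ e')

overlapsᵇ : Interval → Interval → Bool
overlapsᵇ (b , e) (b' , e') = not (e <ᵇ b') ∧ not (e' <ᵇ b)

containsᵇ : Interval → ℕ → Bool
containsᵇ (b , e) k = not (k <ᵇ b) ∧ not (e <ᵇ k)

IsPartition : ℕ → List Interval → Set
IsPartition m L =
  All (λ s → (1 ≤ proj₁ s) × (proj₁ s ≤ proj₂ s) × (proj₂ s ≤ m)) L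
  × (∀ k → 1 ≤ k → k ≤ m → length (filterᵇ (λ s → containsᵇ s k) L) ≡ 1)

ceilDiv : ℕ → (k : ℕ) → .{{NonZero k}} → ℕ
ceilDiv n k = (n + (k ∸ 1)) / k

-- Refine greedily from left to right.  The current segment of haplotype c is
-- closed at column k when (k, c) is a run-top, or when the haplotype c′ = φₖ(c)
-- directly above c closes a segment at k after having closed d − 1 segments
-- during the current segment of c.  Inside a segment of c there is no run-top
-- of c, so φ(c) stays c′ and the segment meets at most d segments of c′.
-- For the count, the potential of c is the number of cuts of φ(c) met by its
-- current segment: a cut of c that is not at a run-top releases d units (the
-- d − 1 stored ones and the cut of c′ triggering it), while every cut feeds at
-- most one unit, since each φₖ is injective.  So the number F of these extra
-- cuts satisfies d F ≤ r̃ + F, and there are at most h + r̃ + F segments.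

module Submission where

open import Defs
open import Data.Nat using (ℕ; suc; _+_; _∸_; _≤_; _<_)
open import Data.Nat.Base using (>-nonZero)
open import Data.Nat.Properties using (m<n⇒0<n∸m)
open import Data.Nat.ListAction using (sum)
open import Data.Fin using (Fin; toℕ)
open import Data.List using (List; map; filterᵇ; length; allFin)
open import Data.List.Relation.Unary.All using (All)
open import Data.List.Relation.Unary.Any using (Any)
open import Data.List.Membership.Propositional using (_∈_)
open import Data.Maybe using (just)
open import Data.Product using (Σ; _×_; _,_)
open import Relation.Binary.PropositionalEquality using (_≡_)

open import Data.Bool using (Bool; true; false; not; _∧_; _∨_; if_then_else_; T)
open import Data.Bool.Properties using (∧-zeroʳ; ∧-identityʳ; ∧-comm; ∨-zeroʳ; ¬-not; T-≡; T-∧; T-∨)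
open import Data.Fin using (zero; suc; fromℕ<)
open import Data.Fin.Properties using (toℕ-injective; toℕ<n; toℕ-fromℕ<; fromℕ<-toℕ)
import Data.Fin.Properties as Fin
open import Data.List using ([]; _∷_; _++_; [_]; reverse; tabulate)
open import Data.List.Properties using (length-map; map-tabulate; reverse-++)
open import Data.List.Membership.Propositional using (lose; find)
open import Data.List.Membership.Propositional.Properties using (∈-allFin; ∈-map∘filter⁻; ∈-map∘filter⁺)
import Data.List.Relation.Unary.All as All
open import Data.List.Relation.Unary.Any using (here; there)
open import Data.Maybe using (Maybe; nothing; maybe′)
open import Data.Nat using (zero; _*_; _≤′_; _≤ᵇ_; _<ᵇ_; _≡ᵇ_; z≤n; s≤s; ≤′-refl; ≤′-step; NonZero)
open import Data.Nat.DivMod using (_/_; m*n/n≡m; /-monoˡ-≤)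
open import Data.Nat.Properties
open import Data.Product using (proj₁; proj₂; ∃-syntax)
open import Data.Sum using (_⊎_; inj₁; inj₂)
import Data.Sum as Sum
open import Data.Vec.Functional using (updateAt)
open import Data.Vec.Functional.Properties using (updateAt-minimal; updateAt-updates)
open import Function using (_∘_; const)
open import Function.Bundles using (Equivalence)
open import Relation.Binary using (tri<; tri≈; tri>)
open import Relation.Binary.PropositionalEquality hiding ([_])
open import Relation.Nullary using (yes; no; contradiction)
open import Relation.Nullary.Decidable using (T?; dec-true; dec-false)
open import Algebra.Properties.CommutativeSemigroup +-commutativeSemigroup using (x∙yz≈y∙xz)
open import Algebra.Properties.Semiring.Sum +-*-semiring
  using (sum-syntax; sum-cong-≗; sum-replicate-zero; ∑-distrib-+; ∑-comm; *-distribʳ-sum) renaming (sum to ∑)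

-- Indicators and finite sums

𝟙 : Bool → ℕ
𝟙 true  = 1
𝟙 false = 0

𝟙-∨ : ∀ x y → 𝟙 (x ∨ y) ≤ 𝟙 x + 𝟙 y
𝟙-∨ true  _ = s≤s z≤n
𝟙-∨ false _ = ≤-refl

𝟙-split : ∀ x y → 𝟙 x ≤ 𝟙 y + 𝟙 (x ∧ not y)
𝟙-split true  true  = s≤s z≤n
𝟙-split true  false = ≤-refl
𝟙-split false _     = z≤n

𝟙-maybe′ : ∀ {A : Set} (p : A → Bool) x → 𝟙 (maybe′ p false x) ≡ maybe′ (𝟙 ∘ p) 0 x
𝟙-maybe′ p (just a) = refl
𝟙-maybe′ p nothing  = refl

∑-1 : ∀ n → ∑[ i < n ] 1 ≡ n
∑-1 zero    = refl
∑-1 (suc n) = cong suc (∑-1 n)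

∑-mono-≤ : ∀ {n} {f g : Fin n → ℕ} → (∀ i → f i ≤ g i) → ∑ f ≤ ∑ g
∑-mono-≤ {zero}  f≤g = z≤n
∑-mono-≤ {suc n} f≤g = +-mono-≤ (f≤g zero) (∑-mono-≤ (f≤g ∘ suc))

∑-mono-< : ∀ {n} {f g : Fin n → ℕ} (i : Fin n) → (∀ i → f i ≤ g i) → f i < g i → ∑ f < ∑ g
∑-mono-< zero    f≤g fi<gi = +-mono-<-≤ fi<gi (∑-mono-≤ (f≤g ∘ suc))
∑-mono-< (suc i) f≤g fi<gi = +-mono-≤-< (f≤g zero) (∑-mono-< i (f≤g ∘ suc) fi<gi)

∑-updateAt : ∀ {n} (w : Fin n → ℕ) a → ∑ w ≡ w a + ∑ (updateAt w a (const 0))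
∑-updateAt w zero    = refl
∑-updateAt w (suc a) = trans (cong (w zero +_) (∑-updateAt (w ∘ suc) a)) (x∙yz≈y∙xz (w zero) (w (suc a)) _)

∑-except : ∀ {n} (f g : Fin n → ℕ) a → (∀ i → i ≢ a → f i ≡ g i) → f a + ∑ g ≡ g a + ∑ f
∑-except f g a f≗g = begin
  f a + ∑ g           ≡⟨ cong (f a +_) (∑-updateAt g a) ⟩
  f a + (g a + ∑ g′)  ≡⟨ x∙yz≈y∙xz (f a) (g a) (∑ g′) ⟩
  g a + (f a + ∑ g′)  ≡⟨ cong (λ s → g a + (f a + s)) (sum-cong-≗ g′≗f′) ⟩
  g a + (f a + ∑ f′)  ≡⟨ cong (g a +_) (∑-updateAt f a) ⟨
  g a + ∑ f           ∎
  where
  open ≡-Reasoning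
  f′ = updateAt f a (const 0)
  g′ = updateAt g a (const 0)
  g′≗f′ : ∀ i → g′ i ≡ f′ i
  g′≗f′ i with i Fin.≟ a
  ... | yes refl = trans (updateAt-updates a g) (sym (updateAt-updates a f))
  ... | no  i≢a  =
    trans (updateAt-minimal i a g i≢a) (trans (sym (f≗g i i≢a)) (sym (updateAt-minimal i a f i≢a)))

∑-partialInjection-≤ : ∀ {n k} (f : Fin n → Maybe (Fin k)) (w : Fin k → ℕ) →
  (∀ {i i′ a} → f i ≡ just a → f i′ ≡ just a → i ≡ i′) → ∑[ i < n ] maybe′ w 0 (f i) ≤ ∑ w
∑-partialInjection-≤ {zero}  f w inj = z≤n
∑-partialInjection-≤ {suc n} f w inj with f zero in f0≡a
... | nothing = ∑-partialInjection-≤ (f ∘ suc) w (λ p q → Fin.suc-injective (inj p q))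
... | just a  = begin
  w a + ∑[ i < n ] maybe′ w 0 (f (suc i))   ≡⟨ cong (w a +_) (sum-cong-≗ unchanged) ⟩
  w a + ∑[ i < n ] maybe′ w′ 0 (f (suc i))  ≤⟨ +-monoʳ-≤ (w a) (∑-partialInjection-≤ (f ∘ suc) w′ inj′) ⟩
  w a + ∑ w′                                ≡⟨ ∑-updateAt w a ⟨
  ∑ w                                       ∎
  where
  open ≤-Reasoning
  w′ = updateAt w a (const 0)
  inj′ : ∀ {i i′ b} → f (suc i) ≡ just b → f (suc i′) ≡ just b → i ≡ i′
  inj′ p q = Fin.suc-injective (inj p q)
  unchanged : ∀ i → maybe′ w 0 (f (suc i)) ≡ maybe′ w′ 0 (f (suc i))
  unchanged i with f (suc i) in fi≡b
  ... | nothing = refl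
  ... | just b  = sym (updateAt-minimal b a w (λ b≡a → Fin.0≢1+n (inj f0≡a (trans fi≡b (cong just b≡a)))))

∑-snoc : ∀ n (f : ℕ → ℕ) → ∑[ k < suc n ] f (toℕ k) ≡ ∑[ k < n ] f (toℕ k) + f n
∑-snoc zero    f = +-identityʳ (f 0)
∑-snoc (suc n) f = trans (cong (f 0 +_) (∑-snoc n (f ∘ suc))) (sym (+-assoc (f 0) _ (f (suc n))))

∑-vanishing : ∀ {m n} (f : ℕ → ℕ) → n ≤ m → (∀ k → n ≤ k → k < m → f k ≡ 0) →
  ∑[ k < m ] f (toℕ k) ≡ ∑[ k < n ] f (toℕ k)
∑-vanishing {zero}      f z≤n _ = refl
∑-vanishing {suc m} {n} f n≤1+m vanish with n ≟ suc m
... | yes refl = refl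
... | no  n≢1+m = begin
  ∑[ k < suc m ] f (toℕ k)     ≡⟨ ∑-snoc m f ⟩
  ∑[ k < m ] f (toℕ k) + f m   ≡⟨ cong (∑[ k < m ] f (toℕ k) +_) (vanish m n≤m (n<1+n m)) ⟩
  ∑[ k < m ] f (toℕ k) + 0     ≡⟨ +-identityʳ _ ⟩
  ∑[ k < m ] f (toℕ k)         ≡⟨ ∑-vanishing f n≤m (λ k n≤k k<m → vanish k n≤k (m<n⇒m<1+n k<m)) ⟩
  ∑[ k < n ] f (toℕ k)         ∎
  where
  open ≡-Reasoning
  n≤m = ≤-pred (≤∧≢⇒< n≤1+m n≢1+m)

∑-telescope-≤ : (a b Φ : ℕ → ℕ) → (∀ k → a k + Φ (suc k) ≤ Φ k + b k) →
  ∀ n → ∑[ k < n ] a (toℕ k) + Φ n ≤ Φ 0 + ∑[ k < n ] b (toℕ k)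
∑-telescope-≤ a b Φ step zero    = ≤-reflexive (+-comm 0 (Φ 0))
∑-telescope-≤ a b Φ step (suc n) = begin
  ∑[ k < suc n ] a (toℕ k) + Φ (suc n)  ≡⟨ cong (_+ Φ (suc n)) (∑-snoc n a) ⟩
  A + a n + Φ (suc n)                   ≡⟨ +-assoc A (a n) (Φ (suc n)) ⟩
  A + (a n + Φ (suc n))                 ≤⟨ +-monoʳ-≤ A (step n) ⟩
  A + (Φ n + b n)                       ≡⟨ +-assoc A (Φ n) (b n) ⟨
  A + Φ n + b n                         ≤⟨ +-monoˡ-≤ (b n) (∑-telescope-≤ a b Φ step n) ⟩
  Φ 0 + B + b n                         ≡⟨ +-assoc (Φ 0) B (b n) ⟩
  Φ 0 + (B + b n)                       ≡⟨ cong (Φ 0 +_) (∑-snoc n b) ⟨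
  Φ 0 + ∑[ k < suc n ] b (toℕ k)        ∎
  where
  open ≤-Reasoning
  A = ∑[ k < n ] a (toℕ k)
  B = ∑[ k < n ] b (toℕ k)

∑-last-≤1 : ∀ n → ∑[ k < n ] 𝟙 (suc (toℕ k) ≡ᵇ n) ≤ 1
∑-last-≤1 zero    = z≤n
∑-last-≤1 (suc n) = ≤-reflexive (begin
  ∑[ k < suc n ] last (toℕ k)       ≡⟨ ∑-snoc n last ⟩
  ∑[ k < n ] last (toℕ k) + last n  ≡⟨ cong₂ _+_ (∑-vanishing last z≤n earlier) (cong 𝟙 (dec-true (n ≟ n) refl)) ⟩
  1                                 ∎)
  where
  open ≡-Reasoning
  last : ℕ → ℕ
  last k = 𝟙 (suc k ≡ᵇ suc n)
  earlier : ∀ k → 0 ≤ k → k < n → last k ≡ 0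
  earlier k _ k<n = cong 𝟙 (dec-false (k ≟ n) (<⇒≢ k<n))

sum-tabulate : ∀ {n} (f : Fin n → ℕ) → sum (tabulate f) ≡ ∑ f
sum-tabulate {zero}  f = refl
sum-tabulate {suc n} f = cong (f zero +_) (sum-tabulate (f ∘ suc))

sum-map-allFin : ∀ {n} (f : Fin n → ℕ) → sum (map f (allFin n)) ≡ ∑ f
sum-map-allFin f = trans (cong sum (map-tabulate (λ i → i) f)) (sum-tabulate f)

length-filterᵇ : ∀ {A : Set} (p : A → Bool) xs → length (filterᵇ p xs) ≡ sum (map (𝟙 ∘ p) xs)
length-filterᵇ p []       = refl
length-filterᵇ p (x ∷ xs) with p x
... | true  = cong suc (length-filterᵇ p xs)
... | false = length-filterᵇ p xs

length-filterᵇ-allFin : ∀ {n} (p : Fin n → Bool) → length (filterᵇ p (allFin n)) ≡ ∑[ i < n ] 𝟙 (p i)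
length-filterᵇ-allFin {n} p = trans (length-filterᵇ p (allFin n)) (sum-map-allFin (𝟙 ∘ p))

length-filterᵇ-map-filterᵇ : ∀ {A B : Set} (w : B → Bool) (g : A → B) (p : A → Bool) xs →
  length (filterᵇ w (map g (filterᵇ p xs))) ≡ length (filterᵇ (λ x → p x ∧ w (g x)) xs)
length-filterᵇ-map-filterᵇ w g p []       = refl
length-filterᵇ-map-filterᵇ w g p (x ∷ xs) with p x
... | false = length-filterᵇ-map-filterᵇ w g p xs
... | true with w (g x)
...   | true  = cong suc (length-filterᵇ-map-filterᵇ w g p xs)
...   | false = length-filterᵇ-map-filterᵇ w g p xs

length-filterᵇ-∷-≤ : ∀ {A : Set} (p : A → Bool) x xs → length (filterᵇ p (x ∷ xs)) ≤ suc (length (filterᵇ p xs))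
length-filterᵇ-∷-≤ p x xs with p x
... | true  = ≤-refl
... | false = n≤1+n _

≤-ceilDiv : ∀ {x n} k .{{_ : NonZero k}} → x * k ≤ n → x ≤ ceilDiv n k
≤-ceilDiv {x} {n} k x*k≤n = begin
  x                  ≡⟨ m*n/n≡m x k ⟨
  x * k / k          ≤⟨ /-monoˡ-≤ k (≤-trans x*k≤n (m≤m+n n (k ∸ 1))) ⟩
  (n + (k ∸ 1)) / k  ∎
  where open ≤-Reasoning

-- Intervals between breakpoints

∈-intervalsFrom-end : ∀ {s L x y} → (x , y) ∈ intervalsFrom s L → y ∈ L
∈-intervalsFrom-end {L = b ∷ bs} (here refl) = here refl
∈-intervalsFrom-end {L = b ∷ bs} (there xy∈) = there (∈-intervalsFrom-end xy∈)

∈-intervalsFrom-start : ∀ {s L x y} → (x , y) ∈ intervalsFrom s L → x ≡ s ⊎ ∃[ z ] z ∈ L × x ≡ suc z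
∈-intervalsFrom-start {L = b ∷ bs} (here refl) = inj₁ refl
∈-intervalsFrom-start {L = b ∷ bs} (there xy∈) with ∈-intervalsFrom-start xy∈
... | inj₁ refl              = inj₂ (b , here refl , refl)
... | inj₂ (z , z∈ , x≡1+z) = inj₂ (z , there z∈ , x≡1+z)

length-intervalsFrom : ∀ s L → length (intervalsFrom s L) ≡ length L
length-intervalsFrom s []       = refl
length-intervalsFrom s (b ∷ bs) = cong suc (length-intervalsFrom (suc b) bs)

-- The breakpoints s ≤ b₀ < b₁ < ⋯ < bₖ = m, so that intervalsFrom s L partitions [s, m].
Breakpoints : ℕ → ℕ → List ℕ → Set
Breakpoints s m []       = s ≡ suc m
Breakpoints s m (b ∷ bs) = s ≤ b × Breakpoints (suc b) m bs

module _ {m : ℕ} where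

  breakpoints-≤ : ∀ {s L} → Breakpoints s m L → s ≤ suc m
  breakpoints-≤ {L = []}     refl        = ≤-refl
  breakpoints-≤ {L = b ∷ bs} (s≤b , bps) = ≤-trans (m≤n⇒m≤1+n s≤b) (breakpoints-≤ bps)

  breakpoints-weaken : ∀ {s L} → Breakpoints (suc s) m L → s ≢ m → Breakpoints s m L
  breakpoints-weaken {L = []}     1+s≡1+m       s≢m = contradiction (suc-injective 1+s≡1+m) s≢m
  breakpoints-weaken {L = b ∷ bs} (1+s≤b , bps) _   = <⇒≤ 1+s≤b , bps

  ∈-breakpoints : ∀ {s L z} → Breakpoints s m L → z ∈ L → s ≤ z
  ∈-breakpoints (s≤b , bps) (here refl) = s≤b
  ∈-breakpoints (s≤b , bps) (there z∈)  = ≤-trans (m≤n⇒m≤1+n s≤b) (∈-breakpoints bps z∈)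

  ∈-intervalsFrom-bounds : ∀ {s L x y} → Breakpoints s m L → (x , y) ∈ intervalsFrom s L →
    s ≤ x × x ≤ y × y ≤ m
  ∈-intervalsFrom-bounds {L = b ∷ bs} (s≤b , bps) (here refl) = ≤-refl , s≤b , ≤-pred (breakpoints-≤ bps)
  ∈-intervalsFrom-bounds {L = b ∷ bs} (s≤b , bps) (there xy∈) =
    let s′≤x , x≤y , y≤m = ∈-intervalsFrom-bounds bps xy∈
    in ≤-trans (m≤n⇒m≤1+n s≤b) s′≤x , x≤y , y≤m

  ∈-intervalsFrom-gap : ∀ {s L x y z} → Breakpoints s m L → (x , y) ∈ intervalsFrom s L →
    z ∈ L → x ≤ z → y ≤ z
  ∈-intervalsFrom-gap {L = b ∷ bs} _         (here refl) (here refl) _   = ≤-refl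
  ∈-intervalsFrom-gap {L = b ∷ bs} (_ , bps) (here refl) (there z∈)  _   = ≤-trans (n≤1+n b) (∈-breakpoints bps z∈)
  ∈-intervalsFrom-gap {L = b ∷ bs} (_ , bps) (there xy∈) (here refl) x≤b =
    contradiction (≤-trans (proj₁ (∈-intervalsFrom-bounds bps xy∈)) x≤b) 1+n≰n
  ∈-intervalsFrom-gap {L = b ∷ bs} (_ , bps) (there xy∈) (there z∈)  x≤z = ∈-intervalsFrom-gap bps xy∈ z∈ x≤z

  covering-interval : ∀ {s L k} → Breakpoints s m L → s ≤ k → k ≤ m →
    Any (λ t → proj₁ t ≤ k × k ≤ proj₂ t) (intervalsFrom s L)
  covering-interval {L = []}         refl      s≤k k≤m = contradiction (≤-trans s≤k k≤m) 1+n≰n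
  covering-interval {L = b ∷ bs} {k} (_ , bps) s≤k k≤m with k ≤? b
  ... | yes k≤b = here (s≤k , k≤b)
  ... | no  k≰b = there (covering-interval bps (≰⇒> k≰b) k≤m)

  count-containing-below : ∀ {s L k} → Breakpoints s m L → k < s →
    length (filterᵇ (λ t → containsᵇ t k) (intervalsFrom s L)) ≡ 0
  count-containing-below {s} {[]}         _           k<s = refl
  count-containing-below {s} {b ∷ bs} {k} (s≤b , bps) k<s rewrite dec-true (k <? s) k<s =
    count-containing-below bps (≤-trans k<s (m≤n⇒m≤1+n s≤b))

  count-containing : ∀ {s L k} → Breakpoints s m L → s ≤ k → k ≤ m →
    length (filterᵇ (λ t → containsᵇ t k) (intervalsFrom s L)) ≡ 1
  count-containing {L = []}         refl      s≤k k≤m = contradiction (≤-trans s≤k k≤m) 1+n≰n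
  count-containing {s} {b ∷ bs} {k} (_ , bps) s≤k k≤m rewrite dec-false (k <? s) (≤⇒≯ s≤k) with k ≤? b
  ... | yes k≤b rewrite dec-false (b <? k) (≤⇒≯ k≤b) = cong suc (count-containing-below bps (s≤s k≤b))
  ... | no  k≰b rewrite dec-true (b <? k) (≰⇒> k≰b)   = count-containing bps (≰⇒> k≰b) k≤m

  breakpoints-partition : ∀ {L} → Breakpoints 1 m L → IsPartition m (intervalsFrom 1 L)
  breakpoints-partition bps =
    All.tabulate (∈-intervalsFrom-bounds bps) , (λ k 1≤k k≤m → count-containing bps 1≤k k≤m)

  intervalsFrom-refine : ∀ {L L′} → Breakpoints 1 m L → Breakpoints 1 m L′ → (∀ {z} → z ∈ L′ → z ∈ L) →
    All (λ t → Any (t ⊆ᵢ_) (intervalsFrom 1 L′)) (intervalsFrom 1 L)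
  intervalsFrom-refine {L} {L′} bps bps′ L′⊆L = All.tabulate refine
    where
    refine : ∀ {t} → t ∈ intervalsFrom 1 L → Any (t ⊆ᵢ_) (intervalsFrom 1 L′)
    refine {x , y} xy∈ with 1≤x , x≤y , y≤m ← ∈-intervalsFrom-bounds bps xy∈
      with (x′ , y′) , xy′∈ , x′≤x , x≤y′ ← find (covering-interval bps′ 1≤x (≤-trans x≤y y≤m)) =
      lose xy′∈ (x′≤x , ∈-intervalsFrom-gap bps xy∈ (L′⊆L (∈-intervalsFrom-end xy′∈)) x≤y′)

  count-overlapping-above : ∀ {s L b e} → Breakpoints s m L → e < s →
    length (filterᵇ (overlapsᵇ (b , e)) (intervalsFrom s L)) ≡ 0
  count-overlapping-above {s} {[]}              _            e<s = refl
  count-overlapping-above {s} {b′ ∷ bs} {b} {e} (s≤b′ , bps) e<s rewrite dec-true (e <? s) e<s =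
    count-overlapping-above {b = b} bps (≤-trans e<s (m≤n⇒m≤1+n s≤b′))

  count-overlapping : ∀ {s L} b e → Breakpoints s m L →
    length (filterᵇ (overlapsᵇ (b , e)) (intervalsFrom s L)) ≤ suc (length (filterᵇ (λ z → (b ≤ᵇ z) ∧ (z <ᵇ e)) L))
  count-overlapping {L = []}      b e _         = z≤n
  count-overlapping {s} {b′ ∷ bs} b e (_ , bps) with b′ <? b
  ... | yes b′<b rewrite dec-true (b′ <? b) b′<b | dec-false (b ≤? b′) (<⇒≱ b′<b) | ∧-zeroʳ (not (e <ᵇ s)) =
    count-overlapping b e bps
  ... | no b′≮b rewrite dec-true (b ≤? b′) (≮⇒≥ b′≮b) with b′ <? e
  ...   | yes b′<e rewrite dec-true (b′ <? e) b′<e =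
    ≤-trans (length-filterᵇ-∷-≤ (overlapsᵇ (b , e)) (s , b′) (intervalsFrom (suc b′) bs))
            (s≤s (count-overlapping b e bps))
  ...   | no  b′≮e rewrite dec-false (b′ <? e) b′≮e =
    ≤-trans (length-filterᵇ-∷-≤ (overlapsᵇ (b , e)) (s , b′) (intervalsFrom (suc b′) bs))
            (s≤s (≤-trans (≤-reflexive (count-overlapping-above {b = b} bps (s≤s (≮⇒≥ b′≮e)))) z≤n))

-- Segments of the columns

module _ {m : ℕ} where

  Consecutive : ℕ → List (Fin m) → Set
  Consecutive a []       = a ≡ m
  Consecutive a (j ∷ js) = toℕ j ≡ a × Consecutive (suc a) js

  consecutive-tabulate : ∀ {n} a (f : Fin n → Fin m) → (∀ i → toℕ (f i) ≡ a + toℕ i) → a + n ≡ m →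
    Consecutive a (tabulate f)
  consecutive-tabulate {zero}  a f f≗a+ a+0≡m = trans (sym (+-identityʳ a)) a+0≡m
  consecutive-tabulate {suc n} a f f≗a+ a+n≡m =
    trans (f≗a+ zero) (+-identityʳ a) ,
    consecutive-tabulate (suc a) (f ∘ suc) (λ i → trans (f≗a+ (suc i)) (+-suc a (toℕ i)))
                         (trans (sym (+-suc a n)) a+n≡m)

  consecutive-allFin : Consecutive 0 (allFin m)
  consecutive-allFin = consecutive-tabulate 0 (λ j → j) (λ _ → refl) refl

  isLast : Fin m → Bool
  isLast j = suc (toℕ j) ≡ᵇ m

  ends : (Fin m → Bool) → List ℕ
  ends q = map (λ j → suc (toℕ j)) (filterᵇ (λ j → isLast j ∨ q j) (allFin m))

  -- hapIntervals S i is segments (λ j → runTop S j i) by definition.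
  segments : (Fin m → Bool) → List Interval
  segments q = intervalsFrom 1 (ends q)

  breakpoints-filter : ∀ (q : Fin m → Bool) {a js} → Consecutive a js →
    Breakpoints (suc a) m (map (λ j → suc (toℕ j)) (filterᵇ (λ j → isLast j ∨ q j) js))
  breakpoints-filter q {js = []}     a≡m            = cong suc a≡m
  breakpoints-filter q {js = j ∷ js} (j≡a , consec) with isLast j ∨ q j in last∨q
  ... | true rewrite j≡a = ≤-refl , breakpoints-filter q consec
  ... | false = breakpoints-weaken (breakpoints-filter q consec) λ 1+a≡m →
    subst T last∨q (Equivalence.from T-∨ (inj₁ (≡⇒≡ᵇ (suc (toℕ j)) m (trans (cong suc j≡a) 1+a≡m))))

  breakpoints-ends : ∀ q → Breakpoints 1 m (ends q)
  breakpoints-ends q = breakpoints-filter q consecutive-allFin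

  ∈-ends⁻ : ∀ {q z} → z ∈ ends q → ∃[ j ] z ≡ suc (toℕ j) × T (isLast j ∨ q j)
  ∈-ends⁻ {q} z∈
    with j , _ , z≡ , last∨q ← ∈-map∘filter⁻ (λ j → suc (toℕ j)) (T? ∘ λ j → isLast j ∨ q j) {xs = allFin m} z∈ =
    j , z≡ , last∨q

  ∈-ends⁺ : ∀ {q} j → T (isLast j ∨ q j) → suc (toℕ j) ∈ ends q
  ∈-ends⁺ {q} j last∨q = ∈-map∘filter⁺ (λ j → suc (toℕ j)) (T? ∘ λ j → isLast j ∨ q j) {xs = allFin m}
    (j , ∈-allFin j , refl , last∨q)

  suc-∈-ends : ∀ (Q : ℕ → Bool) {k} → k < m → Q k ≡ true → suc k ∈ ends (Q ∘ toℕ)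
  suc-∈-ends Q {k} k<m Qk = subst (λ z → suc z ∈ ends (Q ∘ toℕ)) (toℕ-fromℕ< k<m)
    (∈-ends⁺ j (Equivalence.from (T-∨ {isLast j}) (inj₂ (Equivalence.from T-≡ (trans (cong Q (toℕ-fromℕ< k<m)) Qk)))))
    where j = fromℕ< k<m

  ends-mono : ∀ {q q′ z} → (∀ j → q j ≡ true → q′ j ≡ true) → z ∈ ends q → z ∈ ends q′
  ends-mono q⇒q′ z∈ with j , refl , last∨q ← ∈-ends⁻ z∈ =
    ∈-ends⁺ j (Equivalence.from T-∨
      (Sum.map₂ (Equivalence.from T-≡ ∘ q⇒q′ j ∘ Equivalence.to T-≡) (Equivalence.to T-∨ last∨q)))

  segments-partition : ∀ q → IsPartition m (segments q)
  segments-partition q = breakpoints-partition (breakpoints-ends q)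

  segments-refine : ∀ {q q′} → (∀ j → q′ j ≡ true → q j ≡ true) → All (λ t → Any (t ⊆ᵢ_) (segments q′)) (segments q)
  segments-refine {q} {q′} q′⇒q = intervalsFrom-refine (breakpoints-ends q) (breakpoints-ends q′) (ends-mono q′⇒q)

  length-segments : ∀ q → length (segments q) ≤ suc (∑[ j < m ] 𝟙 (q j))
  length-segments q = begin
    length (segments q)                                 ≡⟨ length-intervalsFrom 1 (ends q) ⟩
    length (ends q)                                     ≡⟨ length-map _ (filterᵇ (λ j → isLast j ∨ q j) (allFin m)) ⟩
    length (filterᵇ (λ j → isLast j ∨ q j) (allFin m))  ≡⟨ length-filterᵇ-allFin (λ j → isLast j ∨ q j) ⟩
    ∑[ j < m ] 𝟙 (isLast j ∨ q j)                       ≤⟨ ∑-mono-≤ (λ j → 𝟙-∨ (isLast j) (q j)) ⟩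
    ∑[ j < m ] (𝟙 (isLast j) + 𝟙 (q j))                 ≡⟨ ∑-distrib-+ (𝟙 ∘ isLast) (𝟙 ∘ q) ⟩
    ∑[ j < m ] 𝟙 (isLast j) + ∑[ j < m ] 𝟙 (q j)        ≤⟨ +-monoˡ-≤ _ (∑-last-≤1 m) ⟩
    suc (∑[ j < m ] 𝟙 (q j))                            ∎
    where open ≤-Reasoning

  overlapping-segments : ∀ (Q : ℕ → Bool) b {t} → t < m →
    length (filterᵇ (overlapsᵇ (b , suc t)) (segments (Q ∘ toℕ)))
      ≤ suc (∑[ k < t ] 𝟙 ((b ≤ᵇ suc (toℕ k)) ∧ Q (toℕ k)))
  overlapping-segments Q b {t} t<m = begin
    length (filterᵇ (overlapsᵇ (b , suc t)) (segments (Q ∘ toℕ)))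
      ≤⟨ count-overlapping b (suc t) (breakpoints-ends (Q ∘ toℕ)) ⟩
    suc (length (filterᵇ inside (ends (Q ∘ toℕ))))
      ≡⟨ cong suc (length-filterᵇ-map-filterᵇ inside (λ j → suc (toℕ j)) (λ j → isLast j ∨ Q (toℕ j)) (allFin m)) ⟩
    suc (length (filterᵇ (λ j → (isLast j ∨ Q (toℕ j)) ∧ inside (suc (toℕ j))) (allFin m)))
      ≡⟨ cong suc (length-filterᵇ-allFin (λ j → (isLast j ∨ Q (toℕ j)) ∧ inside (suc (toℕ j)))) ⟩
    suc (∑[ k < m ] end-inside (toℕ k))
      ≡⟨ cong suc (∑-vanishing end-inside (<⇒≤ t<m) vanish) ⟩
    suc (∑[ k < t ] end-inside (toℕ k))
      ≤⟨ s≤s (∑-mono-≤ (λ k → ≤-reflexive (window (toℕ k) (toℕ<n k)))) ⟩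
    suc (∑[ k < t ] 𝟙 ((b ≤ᵇ suc (toℕ k)) ∧ Q (toℕ k))) ∎
    where
    open ≤-Reasoning
    inside : ℕ → Bool
    inside z = (b ≤ᵇ z) ∧ (z <ᵇ suc t)
    end-inside : ℕ → ℕ
    end-inside k = 𝟙 (((suc k ≡ᵇ m) ∨ Q k) ∧ inside (suc k))
    vanish : ∀ k → t ≤ k → k < m → end-inside k ≡ 0
    vanish k t≤k _ rewrite dec-false (k <? t) (≤⇒≯ t≤k) | ∧-zeroʳ (b ≤ᵇ suc k) | ∧-zeroʳ ((suc k ≡ᵇ m) ∨ Q k) = refl
    window : ∀ k → k < t → end-inside k ≡ 𝟙 ((b ≤ᵇ suc k) ∧ Q k)
    window k k<t rewrite dec-false (suc k ≟ m) (<⇒≢ (≤-trans (s≤s k<t) t<m)) | dec-true (k <? t) k<t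
      | ∧-identityʳ (b ≤ᵇ suc k) | ∧-comm (Q k) (b ≤ᵇ suc k) = refl

-- The order of the prefix array

record StrictTotalᵇ {n : ℕ} (R : Fin n → Fin n → Bool) : Set where
  field
    irrefl     : ∀ x → R x x ≡ false
    transitive : ∀ {x y z} → R x y ≡ true → R y z ≡ true → R x z ≡ true
    total      : ∀ {x y} → x ≢ y → R x y ≡ true ⊎ R y x ≡ true

module Predecessors {n : ℕ} {R : Fin n → Fin n → Bool} (R-order : StrictTotalᵇ R) where
  open StrictTotalᵇ R-order

  predecessors : Fin n → ℕ
  predecessors y = ∑[ z < n ] 𝟙 (R z y)

  predecessors-mono : ∀ {x y} → R x y ≡ true → predecessors x < predecessors y
  predecessors-mono {x} {y} Rxy = ∑-mono-< x R-mono strict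
    where
    strict : 𝟙 (R x x) < 𝟙 (R x y)
    strict rewrite irrefl x | Rxy = ≤-refl
    R-mono : ∀ z → 𝟙 (R z x) ≤ 𝟙 (R z y)
    R-mono z with R z x in Rzx
    ... | true  rewrite transitive Rzx Rxy = ≤-refl
    ... | false = z≤n

  predecessors-injective : ∀ {x y} → predecessors x ≡ predecessors y → x ≡ y
  predecessors-injective {x} {y} px≡py with x Fin.≟ y
  ... | yes x≡y = x≡y
  ... | no  x≢y with total x≢y
  ...   | inj₁ Rxy = contradiction px≡py (<⇒≢ (predecessors-mono Rxy))
  ...   | inj₂ Ryx = contradiction (sym px≡py) (<⇒≢ (predecessors-mono Ryx))

  R≡predecessors-< : ∀ x y → R x y ≡ (predecessors x <ᵇ predecessors y)
  R≡predecessors-< x y with R x y in Rxy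
  ... | true  = sym (dec-true (predecessors x <? predecessors y) (predecessors-mono Rxy))
  ... | false with x Fin.≟ y
  ...   | yes refl = sym (dec-false (predecessors x <? predecessors x) (<-irrefl refl))
  ...   | no  x≢y with total x≢y
  ...     | inj₁ Rxy′ = contradiction (trans (sym Rxy) Rxy′) λ ()
  ...     | inj₂ Ryx  = sym (dec-false (predecessors x <? predecessors y) (<⇒≯ (predecessors-mono Ryx)))

lexStep : ℕ → ℕ → Bool → Bool
lexStep u v b = if u ≡ᵇ v then b else u <ᵇ v

lexStep-< : ∀ {u v} b → u < v → lexStep u v b ≡ true
lexStep-< {u} {v} b u<v rewrite dec-false (u ≟ v) (<⇒≢ u<v) = dec-true (u <? v) u<v

lexStep-≡ : ∀ u b → lexStep u u b ≡ b
lexStep-≡ u b rewrite dec-true (u ≟ u) refl = refl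

lexStep-true : ∀ u v b → lexStep u v b ≡ true → u < v ⊎ (u ≡ v × b ≡ true)
lexStep-true u v b step with u ≡ᵇ v in u≡ᵇv
... | true  = inj₂ (≡ᵇ⇒≡ u v (Equivalence.from T-≡ u≡ᵇv) , step)
... | false = inj₁ (<ᵇ⇒< u v (Equivalence.from T-≡ step))

<ᵇ-suc : ∀ {x r} → x ≢ r → (x <ᵇ suc r) ≡ (x <ᵇ r)
<ᵇ-suc {x} {r} x≢r with <-cmp x r
... | tri< x<r _ _ = trans (dec-true (x <? suc r) (m<n⇒m<1+n x<r)) (sym (dec-true (x <? r) x<r))
... | tri≈ _ x≡r _ = contradiction x≡r x≢r
... | tri> _ _ r<x = trans (dec-false (x <? suc r) (≤⇒≯ r<x)) (sym (dec-false (x <? r) (<⇒≯ r<x)))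

findFirst-sound : ∀ {A : Set} (p : A → Bool) xs {y} → findFirst p xs ≡ just y → p y ≡ true
findFirst-sound p (x ∷ xs) found with p x in px
... | true  with refl ← found = px
... | false = findFirst-sound p xs found

findFirst-complete : ∀ {A : Set} (p : A → Bool) xs {x} → x ∈ xs → p x ≡ true → ∃[ y ] findFirst p xs ≡ just y
findFirst-complete p (x ∷ xs) x∈ px with p x in px′
... | true  = x , refl
findFirst-complete p (x ∷ xs) (here refl) px | false = contradiction (trans (sym px′) px) λ ()
findFirst-complete p (x ∷ xs) (there x∈)  px | false = findFirst-complete p xs x∈ px

module _ {m : ℕ} where

  filter-below-none : ∀ {a} (js : List (Fin m)) {k} → Consecutive a js → k ≤ a →
    filterᵇ (λ p → toℕ p <ᵇ k) js ≡ []
  filter-below-none []       _                  _   = refl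
  filter-below-none (i ∷ js) {k} (i≡a , consec) k≤a
    rewrite dec-false (toℕ i <? k) (≤⇒≯ (subst (k ≤_) (sym i≡a) k≤a)) =
    filter-below-none js consec (m≤n⇒m≤1+n k≤a)

  filter-below-snoc : ∀ {a} (js : List (Fin m)) j → Consecutive a js → a ≤ toℕ j →
    filterᵇ (λ p → toℕ p <ᵇ suc (toℕ j)) js ≡ filterᵇ (λ p → toℕ p <ᵇ toℕ j) js ++ [ j ]
  filter-below-snoc []       j a≡m            a≤j = contradiction (subst (_≤ toℕ j) a≡m a≤j) (<⇒≱ (toℕ<n j))
  filter-below-snoc (i ∷ js) j (i≡a , consec) a≤j with i Fin.≟ j
  ... | yes refl rewrite dec-true (toℕ i <? suc (toℕ i)) ≤-refl | dec-false (toℕ i <? toℕ i) (<-irrefl refl) =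
    trans (cong (i ∷_) (filter-below-none js consec (≤-reflexive (cong suc i≡a))))
          (cong (_++ [ i ]) (sym (filter-below-none js consec (m≤n⇒m≤1+n (≤-reflexive i≡a)))))
  ... | no i≢j with i≤j ← subst (_≤ toℕ j) (sym i≡a) a≤j
    rewrite dec-true (toℕ i <? suc (toℕ j)) (s≤s i≤j) | dec-true (toℕ i <? toℕ j) (≤∧≢⇒< i≤j (i≢j ∘ toℕ-injective)) =
    cong (i ∷_) (filter-below-snoc js j consec (≤∧≢⇒< a≤j (λ a≡j → i≢j (toℕ-injective (trans i≡a a≡j)))))

  reverse-below-suc : ∀ (j j′ : Fin m) → toℕ j′ ≡ suc (toℕ j) → reverse (below j′) ≡ j ∷ reverse (below j)
  reverse-below-suc j j′ j′≡1+j = begin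
    reverse (below j′)
      ≡⟨ cong (λ k → reverse (filterᵇ (λ p → toℕ p <ᵇ k) (allFin m))) j′≡1+j ⟩
    reverse (filterᵇ (λ p → toℕ p <ᵇ suc (toℕ j)) (allFin m))
      ≡⟨ cong reverse (filter-below-snoc (allFin m) j consecutive-allFin z≤n) ⟩
    reverse (below j ++ [ j ])                                 ≡⟨ reverse-++ (below j) [ j ] ⟩
    j ∷ reverse (below j)                                      ∎
    where open ≡-Reasoning

module Colex {h m : ℕ} (S : Panel h m) where

  lexBefore : List (Fin m) → Fin h → Fin h → Bool
  lexBefore []       x y = toℕ x <ᵇ toℕ y
  lexBefore (p ∷ ps) x y = lexStep (S x p) (S y p) (lexBefore ps x y)

  lexBefore-order : ∀ ps → StrictTotalᵇ (lexBefore ps)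
  lexBefore-order [] = record
    { irrefl = irrefl′ ; transitive = λ {x y z} → transitive′ {x} {y} {z} ; total = λ {x y} → total′ {x} {y} }
    where
    irrefl′ : ∀ x → (toℕ x <ᵇ toℕ x) ≡ false
    irrefl′ x = dec-false (toℕ x <? toℕ x) (<-irrefl refl)
    transitive′ : ∀ {x y z} → (toℕ x <ᵇ toℕ y) ≡ true → (toℕ y <ᵇ toℕ z) ≡ true → (toℕ x <ᵇ toℕ z) ≡ true
    transitive′ {x} {y} {z} x<y y<z =
      dec-true (toℕ x <? toℕ z) (<-trans (<ᵇ⇒< _ _ (Equivalence.from T-≡ x<y)) (<ᵇ⇒< _ _ (Equivalence.from T-≡ y<z)))
    total′ : ∀ {x y} → x ≢ y → (toℕ x <ᵇ toℕ y) ≡ true ⊎ (toℕ y <ᵇ toℕ x) ≡ true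
    total′ {x} {y} x≢y with <-cmp (toℕ x) (toℕ y)
    ... | tri< x<y _ _ = inj₁ (dec-true (toℕ x <? toℕ y) x<y)
    ... | tri≈ _ x≡y _ = contradiction (toℕ-injective x≡y) x≢y
    ... | tri> _ _ y<x = inj₂ (dec-true (toℕ y <? toℕ x) y<x)
  lexBefore-order (p ∷ ps) = record { irrefl = irrefl′ ; transitive = transitive′ ; total = total′ }
    where
    open StrictTotalᵇ (lexBefore-order ps)
    irrefl′ : ∀ x → lexBefore (p ∷ ps) x x ≡ false
    irrefl′ x = trans (lexStep-≡ (S x p) _) (irrefl x)
    transitive′ : ∀ {x y z} → lexBefore (p ∷ ps) x y ≡ true → lexBefore (p ∷ ps) y z ≡ true →
      lexBefore (p ∷ ps) x z ≡ true
    transitive′ {x} {y} {z} x<y y<z with lexStep-true _ _ _ x<y | lexStep-true _ _ _ y<z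
    ... | inj₁ x<ₚy          | inj₁ y<ₚz          = lexStep-< _ (<-trans x<ₚy y<ₚz)
    ... | inj₁ x<ₚy          | inj₂ (y≡ₚz , _)    = lexStep-< _ (subst (S x p <_) y≡ₚz x<ₚy)
    ... | inj₂ (x≡ₚy , _)    | inj₁ y<ₚz          = lexStep-< _ (subst (_< S z p) (sym x≡ₚy) y<ₚz)
    ... | inj₂ (x≡ₚy , x<y′) | inj₂ (y≡ₚz , y<z′) rewrite x≡ₚy | y≡ₚz =
      trans (lexStep-≡ (S z p) _) (transitive x<y′ y<z′)
    total′ : ∀ {x y} → x ≢ y → lexBefore (p ∷ ps) x y ≡ true ⊎ lexBefore (p ∷ ps) y x ≡ true
    total′ {x} {y} x≢y with <-cmp (S x p) (S y p)
    ... | tri< x<ₚy _ _ = inj₁ (lexStep-< _ x<ₚy)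
    ... | tri> _ _ y<ₚx = inj₂ (lexStep-< _ y<ₚx)
    ... | tri≈ _ x≡ₚy _ rewrite x≡ₚy = Sum.map (trans (lexStep-≡ (S y p) _)) (trans (lexStep-≡ (S y p) _)) (total x≢y)

  lexBefore-firstDiff-just : ∀ {x y p} ps → firstDiff (S x) (S y) ps ≡ just p → lexBefore ps x y ≡ (S x p <ᵇ S y p)
  lexBefore-firstDiff-just {x} {y} (q ∷ ps) diff with S x q ≡ᵇ S y q
  ... | true  = lexBefore-firstDiff-just ps diff
  ... | false with refl ← diff = refl

  lexBefore-firstDiff-nothing : ∀ {x y} ps → firstDiff (S x) (S y) ps ≡ nothing → lexBefore ps x y ≡ (toℕ x <ᵇ toℕ y)
  lexBefore-firstDiff-nothing                []       _    = refl
  lexBefore-firstDiff-nothing {x} {y} (q ∷ ps) diff with S x q ≡ᵇ S y q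
  ... | true = lexBefore-firstDiff-nothing ps diff

  colexBefore≡lexBefore : ∀ j x y → colexBefore S j x y ≡ lexBefore (reverse (below j)) x y
  colexBefore≡lexBefore j x y with firstDiff (S x) (S y) (reverse (below j)) in diff
  ... | just p  = sym (lexBefore-firstDiff-just (reverse (below j)) diff)
  ... | nothing = sym (lexBefore-firstDiff-nothing (reverse (below j)) diff)

  colexBefore-order : ∀ j → StrictTotalᵇ (colexBefore S j)
  colexBefore-order j = record
    { irrefl     = λ x → trans (colexBefore≡lexBefore j x x) (irrefl x)
    ; transitive = λ {x y z} x<y y<z → trans (colexBefore≡lexBefore j x z)
        (transitive (trans (sym (colexBefore≡lexBefore j x y)) x<y) (trans (sym (colexBefore≡lexBefore j y z)) y<z))
    ; total      = λ {x y} x≢y →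
        Sum.map (trans (colexBefore≡lexBefore j x y)) (trans (colexBefore≡lexBefore j y x)) (total x≢y)
    }
    where open StrictTotalᵇ (lexBefore-order (reverse (below j)))

  colexBefore-suc : ∀ {j j′} → toℕ j′ ≡ suc (toℕ j) → ∀ x y →
    colexBefore S j′ x y ≡ lexStep (S x j) (S y j) (colexBefore S j x y)
  colexBefore-suc {j} {j′} j′≡1+j x y
    rewrite colexBefore≡lexBefore j′ x y | reverse-below-suc j j′ j′≡1+j | colexBefore≡lexBefore j x y = refl

  module _ {j : Fin m} where
    open Predecessors (colexBefore-order j)

    rank≡predecessors : ∀ i → rank S j i ≡ predecessors i
    rank≡predecessors i = length-filterᵇ-allFin (λ i′ → colexBefore S j i′ i)

    rank-injective : ∀ {x y} → rank S j x ≡ rank S j y → x ≡ y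
    rank-injective {x} {y} rx≡ry =
      predecessors-injective (trans (sym (rank≡predecessors x)) (trans rx≡ry (rank≡predecessors y)))

    colexBefore≡rank-< : ∀ x y → colexBefore S j x y ≡ (rank S j x <ᵇ rank S j y)
    colexBefore≡rank-< x y rewrite rank≡predecessors x | rank≡predecessors y = R≡predecessors-< x y

    φ-rank : ∀ {c c′} → φ S j c ≡ just c′ → rank S j c ≡ suc (rank S j c′)
    φ-rank {c} φc≡c′ with rank S j c
    ... | suc r = cong suc (sym (≡ᵇ⇒≡ _ _ (Equivalence.from T-≡ (findFirst-sound _ (allFin h) φc≡c′))))

    rank-φ : ∀ {c c′} → rank S j c ≡ suc (rank S j c′) → φ S j c ≡ just c′
    rank-φ {c} {c′} rc≡1+rc′ with rank S j c
    ... | suc r with refl ← rc≡1+rc′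
      with c″ , found ← findFirst-complete (λ i → rank S j i ≡ᵇ rank S j c′) (allFin h) (∈-allFin c′)
                                           (dec-true (rank S j c′ ≟ rank S j c′) refl) =
      trans found (cong just (rank-injective (≡ᵇ⇒≡ _ _ (Equivalence.from T-≡ (findFirst-sound _ (allFin h) found)))))

    φ-injective : ∀ {c₁ c₂ c′} → φ S j c₁ ≡ just c′ → φ S j c₂ ≡ just c′ → c₁ ≡ c₂
    φ-injective φc₁≡c′ φc₂≡c′ = rank-injective (trans (φ-rank φc₁≡c′) (sym (φ-rank φc₂≡c′)))

    runTop-false : ∀ {c} → runTop S j c ≡ false → ∃[ c′ ] φ S j c ≡ just c′ × S c′ j ≡ S c j
    runTop-false {c} top≡false with φ S j c
    ... | nothing = contradiction top≡false λ ()
    ... | just c′ with S c′ j ≡ᵇ S c j in same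
    ...   | true = c′ , refl , ≡ᵇ⇒≡ _ _ (Equivalence.from T-≡ same)

  -- If c and the haplotype c′ above it agree at column j, they stay adjacent:
  -- every other z lies before c at column j + 1 exactly when it lies before c′.
  φ-stable : ∀ {j j′ c} → toℕ j′ ≡ suc (toℕ j) → runTop S j c ≡ false → φ S j′ c ≡ φ S j c
  φ-stable {j} {j′} {c} j′≡1+j top≡false with c′ , φc≡c′ , Sc′≡Sc ← runTop-false top≡false =
    trans (rank-φ rank′c≡1+rank′c′) (sym φc≡c′)
    where
    rc≡1+rc′ : rank S j c ≡ suc (rank S j c′)
    rc≡1+rc′ = φ-rank φc≡c′
    before′ : Fin h → Fin h → ℕ
    before′ y z = 𝟙 (colexBefore S j′ z y)
    same-before′ : ∀ z → z ≢ c′ → before′ c z ≡ before′ c′ z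
    same-before′ z z≢c′
      rewrite colexBefore-suc j′≡1+j z c | colexBefore-suc j′≡1+j z c′ | Sc′≡Sc
            | colexBefore≡rank-< {j} z c | colexBefore≡rank-< {j} z c′ | rc≡1+rc′ =
      cong (𝟙 ∘ lexStep (S z j) (S c j)) (<ᵇ-suc (z≢c′ ∘ rank-injective {j}))
    c′-before′-c : before′ c c′ ≡ 1
    c′-before′-c rewrite colexBefore-suc j′≡1+j c′ c | Sc′≡Sc | lexStep-≡ (S c j) (colexBefore S j c′ c)
      | colexBefore≡rank-< {j} c′ c | rc≡1+rc′ = cong 𝟙 (dec-true (rank S j c′ <? suc (rank S j c′)) ≤-refl)
    c′-before′-c′ : before′ c′ c′ ≡ 0
    c′-before′-c′ = cong 𝟙 (StrictTotalᵇ.irrefl (colexBefore-order j′) c′)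
    rank′c≡1+rank′c′ : rank S j′ c ≡ suc (rank S j′ c′)
    rank′c≡1+rank′c′ = begin
      rank S j′ c                    ≡⟨ rank≡predecessors {j′} c ⟩
      0 + ∑ (before′ c)              ≡⟨ cong (_+ ∑ (before′ c)) c′-before′-c′ ⟨
      before′ c′ c′ + ∑ (before′ c)  ≡⟨ ∑-except (before′ c) (before′ c′) c′ same-before′ ⟨
      before′ c c′ + ∑ (before′ c′)  ≡⟨ cong₂ _+_ c′-before′-c (sym (rank≡predecessors {j′} c′)) ⟩
      suc (rank S j′ c′)             ∎
      where open ≡-Reasoning

-- The greedy refinement

module Refinement {h m : ℕ}
  (top   : ℕ → Fin h → Bool)
  (above : ℕ → Fin h → Maybe (Fin h))
  (rank  : ℕ → Fin h → ℕ)
  (δ     : ℕ)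
  where

  -- counter k c is the number of cuts of the haplotype above c met by the
  -- current segment of c before column k; its capacity is δ = d − 1.  The rule
  -- for cut k c consults the haplotype above c, whose rank is one less, so
  -- suc (rank k c) unfoldings of cutWithin suffice.
  cutWithin : ℕ → (Fin h → ℕ) → ℕ → Fin h → Bool
  cutWithin zero    load k c = top k c
  cutWithin (suc n) load k c = top k c ∨ (maybe′ (cutWithin n load k) false (above k c) ∧ (load c ≡ᵇ δ))

  counter  : ℕ → Fin h → ℕ
  cut      : ℕ → Fin h → Bool
  aboveCut : ℕ → Fin h → Bool

  counter zero    c = 0
  counter (suc k) c = if cut k c then 0 else 𝟙 (aboveCut k c) + counter k c

  cut k c = cutWithin (suc (rank k c)) (counter k) k c

  aboveCut k c = maybe′ (cut k) false (above k c)

  forced : ℕ → Fin h → Bool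
  forced k c = cut k c ∧ not (top k c)

  refined : Fin h → List Interval
  refined c = segments {m} (λ j → cut (toℕ j) c)

  top⇒cut : ∀ {k c} → top k c ≡ true → cut k c ≡ true
  top⇒cut top≡true rewrite top≡true = refl

  uncut⇒¬top : ∀ {k c} → cut k c ≡ false → top k c ≡ false
  uncut⇒¬top cut≡false = ¬-not λ top≡true → contradiction (trans (sym (top⇒cut top≡true)) cut≡false) λ ()

  counter-window : ∀ {a t c c′} → (∀ k → a ≤ k → k < t → cut k c ≡ false × above k c ≡ just c′) →
    counter a c ≡ 0 → a ≤′ t → counter t c ≡ ∑[ k < t ] 𝟙 ((suc a ≤ᵇ suc (toℕ k)) ∧ cut (toℕ k) c′)
  counter-window {a} {c′ = c′} _ counter≡0 ≤′-refl = trans counter≡0 (sym (∑-vanishing _ z≤n before-a))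
    where
    before-a : ∀ k → 0 ≤ k → k < a → 𝟙 ((suc a ≤ᵇ suc k) ∧ cut k c′) ≡ 0
    before-a k _ k<a rewrite dec-false (a <? suc k) (≤⇒≯ k<a) = refl
  counter-window {a} {suc t} {c} {c′} quiet counter≡0 (≤′-step a≤′t)
    with cut≡false , above≡c′ ← quiet t (≤′⇒≤ a≤′t) ≤-refl rewrite cut≡false | above≡c′ = begin
    𝟙 (cut t c′) + counter t c                ≡⟨ cong (𝟙 (cut t c′) +_) (counter-window quiet′ counter≡0 a≤′t) ⟩
    𝟙 (cut t c′) + ∑[ k < t ] window (toℕ k)  ≡⟨ +-comm (𝟙 (cut t c′)) _ ⟩
    ∑[ k < t ] window (toℕ k) + 𝟙 (cut t c′)
      ≡⟨ cong (λ b → ∑[ k < t ] window (toℕ k) + 𝟙 (b ∧ cut t c′)) (dec-true (a <? suc t) (s≤s (≤′⇒≤ a≤′t))) ⟨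
    ∑[ k < t ] window (toℕ k) + window t      ≡⟨ ∑-snoc t window ⟨
    ∑[ k < suc t ] window (toℕ k)             ∎
    where
    open ≡-Reasoning
    window : ℕ → ℕ
    window k = 𝟙 ((suc a ≤ᵇ suc k) ∧ cut k c′)
    quiet′ : ∀ k → a ≤ k → k < t → cut k c ≡ false × above k c ≡ just c′
    quiet′ k a≤k k<t = quiet k a≤k (m<n⇒m<1+n k<t)

  Φ : ℕ → ℕ
  Φ k = ∑[ c < h ] counter k c

  Forced Cuts Tops : ℕ
  Forced = ∑[ k < m ] ∑[ c < h ] 𝟙 (forced (toℕ k) c)
  Cuts   = ∑[ k < m ] ∑[ c < h ] 𝟙 (cut (toℕ k) c)
  Tops   = ∑[ k < m ] ∑[ c < h ] 𝟙 (top (toℕ k) c)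

  cuts-≤ : Cuts ≤ Tops + Forced
  cuts-≤ = begin
    Cuts
      ≤⟨ ∑-mono-≤ {m} (λ k → ∑-mono-≤ (𝟙-cut-≤ (toℕ k))) ⟩
    ∑[ k < m ] ∑[ c < h ] (𝟙 (top (toℕ k) c) + 𝟙 (forced (toℕ k) c))
      ≡⟨ sum-cong-≗ {m} (λ k → ∑-distrib-+ (𝟙 ∘ top (toℕ k)) (𝟙 ∘ forced (toℕ k))) ⟩
    ∑[ k < m ] (∑[ c < h ] 𝟙 (top (toℕ k) c) + ∑[ c < h ] 𝟙 (forced (toℕ k) c))
      ≡⟨ ∑-distrib-+ {m} (λ k → ∑[ c < h ] 𝟙 (top (toℕ k) c)) _ ⟩
    Tops + Forced ∎
    where
    open ≤-Reasoning
    𝟙-cut-≤ : ∀ k c → 𝟙 (cut k c) ≤ 𝟙 (top k c) + 𝟙 (forced k c)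
    𝟙-cut-≤ k c = 𝟙-split (cut k c) (top k c)

  module _ (rank-above : ∀ {k c c′} → above k c ≡ just c′ → rank k c ≡ suc (rank k c′)) where

    cut-unfold : ∀ k c → cut k c ≡ top k c ∨ (aboveCut k c ∧ (counter k c ≡ᵇ δ))
    cut-unfold k c with above k c in above≡
    ... | nothing = refl
    ... | just c′ rewrite rank-above above≡ = refl

    cut-full : ∀ {k c} → aboveCut k c ≡ true → counter k c ≡ δ → cut k c ≡ true
    cut-full {k} {c} aboveCut≡true counter≡δ
      rewrite cut-unfold k c | aboveCut≡true | dec-true (counter k c ≟ δ) counter≡δ = ∨-zeroʳ (top k c)

    forced-full : ∀ {k c} → cut k c ≡ true → top k c ≡ false → aboveCut k c ≡ true × counter k c ≡ δ
    forced-full {k} {c} cut≡true top≡false =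
      Equivalence.to T-≡ (proj₁ aboveCut∧full) , ≡ᵇ⇒≡ (counter k c) δ (proj₂ aboveCut∧full)
      where
      aboveCut∧full : T (aboveCut k c) × T (counter k c ≡ᵇ δ)
      aboveCut∧full = Equivalence.to T-∧ (Equivalence.from T-≡
        (trans (sym (trans (cut-unfold k c) (cong (_∨ (aboveCut k c ∧ (counter k c ≡ᵇ δ))) top≡false))) cut≡true))

    counter-≤ : ∀ k c → counter k c ≤ δ
    counter-≤ zero    c = z≤n
    counter-≤ (suc k) c with cut k c in cut≡ | aboveCut k c in aboveCut≡
    ... | true  | _     = z≤n
    ... | false | false = counter-≤ k c
    ... | false | true  = ≤∧≢⇒< (counter-≤ k c) λ counter≡δ →
      contradiction (trans (sym (cut-full aboveCut≡ counter≡δ)) cut≡) λ ()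

    counter-step : ∀ k c → 𝟙 (forced k c) * suc δ + counter (suc k) c ≤ counter k c + 𝟙 (aboveCut k c)
    counter-step k c = pay (cut k c) (top k c) forced-full
      where
      pay : ∀ cut? top? → (cut? ≡ true → top? ≡ false → aboveCut k c ≡ true × counter k c ≡ δ) →
        𝟙 (cut? ∧ not top?) * suc δ + (if cut? then 0 else 𝟙 (aboveCut k c) + counter k c)
          ≤ counter k c + 𝟙 (aboveCut k c)
      pay false _     _    = ≤-reflexive (+-comm (𝟙 (aboveCut k c)) (counter k c))
      pay true  true  _    = z≤n
      pay true  false full with aboveCut≡true , counter≡δ ← full refl refl rewrite aboveCut≡true | counter≡δ =
        ≤-reflexive (trans (+-identityʳ (1 * suc δ)) (trans (*-identityˡ (suc δ)) (+-comm 1 δ)))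

    module _ (above-injective : ∀ {k c₁ c₂ c′} → above k c₁ ≡ just c′ → above k c₂ ≡ just c′ → c₁ ≡ c₂) where

      ∑-aboveCut-≤ : ∀ k → ∑[ c < h ] 𝟙 (aboveCut k c) ≤ ∑[ c < h ] 𝟙 (cut k c)
      ∑-aboveCut-≤ k = begin
        ∑[ c < h ] 𝟙 (aboveCut k c)                  ≡⟨ sum-cong-≗ (λ c → 𝟙-maybe′ (cut k) (above k c)) ⟩
        ∑[ c < h ] maybe′ (𝟙 ∘ cut k) 0 (above k c)  ≤⟨ ∑-partialInjection-≤ (above k) (𝟙 ∘ cut k) above-injective ⟩
        ∑[ c < h ] 𝟙 (cut k c)                       ∎
        where open ≤-Reasoning

      potential-step : ∀ k → (∑[ c < h ] 𝟙 (forced k c)) * suc δ + Φ (suc k) ≤ Φ k + ∑[ c < h ] 𝟙 (cut k c)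
      potential-step k = begin
        (∑[ c < h ] 𝟙 (forced k c)) * suc δ + Φ (suc k)
          ≡⟨ cong (_+ Φ (suc k)) (*-distribʳ-sum (suc δ) (𝟙 ∘ forced k)) ⟩
        ∑[ c < h ] (𝟙 (forced k c) * suc δ) + Φ (suc k)
          ≡⟨ ∑-distrib-+ (λ c → 𝟙 (forced k c) * suc δ) (counter (suc k)) ⟨
        ∑[ c < h ] (𝟙 (forced k c) * suc δ + counter (suc k) c)  ≤⟨ ∑-mono-≤ (counter-step k) ⟩
        ∑[ c < h ] (counter k c + 𝟙 (aboveCut k c))              ≡⟨ ∑-distrib-+ (counter k) (𝟙 ∘ aboveCut k) ⟩
        Φ k + ∑[ c < h ] 𝟙 (aboveCut k c)                        ≤⟨ +-monoʳ-≤ (Φ k) (∑-aboveCut-≤ k) ⟩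
        Φ k + ∑[ c < h ] 𝟙 (cut k c)                             ∎
        where open ≤-Reasoning

      forced-≤ : Forced * δ ≤ Tops
      forced-≤ = +-cancelˡ-≤ Forced (Forced * δ) Tops (begin
        Forced + Forced * δ                  ≡⟨ *-suc Forced δ ⟨
        Forced * suc δ                       ≡⟨ *-distribʳ-sum {m} (suc δ) (λ k → ∑[ c < h ] 𝟙 (forced (toℕ k) c)) ⟩
        ∑[ k < m ] weighted (toℕ k)          ≤⟨ m≤m+n _ (Φ m) ⟩
        ∑[ k < m ] weighted (toℕ k) + Φ m
          ≤⟨ ∑-telescope-≤ weighted (λ k → ∑[ c < h ] 𝟙 (cut k c)) Φ potential-step m ⟩
        Φ 0 + Cuts                           ≡⟨ cong (_+ Cuts) (sum-replicate-zero h) ⟩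
        Cuts                                 ≤⟨ cuts-≤ ⟩
        Tops + Forced                        ≡⟨ +-comm Tops Forced ⟩
        Forced + Tops                        ∎)
        where
        open ≤-Reasoning
        weighted : ℕ → ℕ
        weighted k = (∑[ c < h ] 𝟙 (forced k c)) * suc δ

      ∑-length-refined : ∑[ c < h ] length (refined c) ≤ h + (Tops + Forced)
      ∑-length-refined = begin
        ∑[ c < h ] length (refined c)
          ≤⟨ ∑-mono-≤ {h} (λ c → length-segments {m} (λ j → cut (toℕ j) c)) ⟩
        ∑[ c < h ] (1 + ∑[ k < m ] 𝟙 (cut (toℕ k) c))
          ≡⟨ ∑-distrib-+ {h} (λ _ → 1) (λ c → ∑[ k < m ] 𝟙 (cut (toℕ k) c)) ⟩
        ∑[ c < h ] 1 + ∑[ c < h ] ∑[ k < m ] 𝟙 (cut (toℕ k) c)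
          ≡⟨ cong₂ _+_ (∑-1 h) (∑-comm {h} {m} (λ c k → 𝟙 (cut (toℕ k) c))) ⟩
        h + Cuts                                                ≤⟨ +-monoʳ-≤ h cuts-≤ ⟩
        h + (Tops + Forced)                                     ∎
        where open ≤-Reasoning

    module _ (above-stable : ∀ {k c} → suc k < m → top k c ≡ false → above (suc k) c ≡ above k c) where

      refined-uncut : ∀ {c a t} → (suc a , suc t) ∈ refined c → ∀ k → a ≤ k → k < t → cut k c ≡ false
      refined-uncut {c} seg k a≤k k<t with cut k c in cut≡
      ... | false = refl
      ... | true  = contradiction (∈-intervalsFrom-gap (breakpoints-ends _) seg end (s≤s a≤k)) (<⇒≱ (s≤s k<t))
        where
        end : suc k ∈ ends (λ j → cut (toℕ j) c)
        end = suc-∈-ends (λ k → cut k c)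
          (<-trans k<t (proj₂ (proj₂ (∈-intervalsFrom-bounds (breakpoints-ends _) seg)))) cut≡

      refined-counter-start : ∀ {c a e} → (suc a , e) ∈ refined c → counter a c ≡ 0
      refined-counter-start {c} seg with ∈-intervalsFrom-start seg
      ... | inj₁ refl = refl
      ... | inj₂ (z , z∈ , refl) with j , refl , last∨cut ← ∈-ends⁻ z∈ | isLast j in last≡
      ...   | false rewrite Equivalence.to T-≡ last∨cut = refl
      ...   | true  with _ , x≤y , y≤m ← ∈-intervalsFrom-bounds (breakpoints-ends _) seg =
        contradiction (subst (suc (suc (toℕ j)) ≤_) (sym (≡ᵇ⇒≡ _ m (Equivalence.from T-≡ last≡))) (≤-trans x≤y y≤m))
                      1+n≰n

      above-constant : ∀ {c a t} → t < m → (∀ k → a ≤ k → k < t → top k c ≡ false) →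
        ∀ {k} → a ≤ k → k ≤′ t → above k c ≡ above t c
      above-constant t<m quiet a≤k ≤′-refl = refl
      above-constant {t = suc t} 1+t<m quiet a≤k (≤′-step k≤′t) =
        trans (above-constant (<-trans (n<1+n t) 1+t<m) (λ k a≤k k<t → quiet k a≤k (m<n⇒m<1+n k<t)) a≤k k≤′t)
              (sym (above-stable 1+t<m (quiet t (≤-trans a≤k (≤′⇒≤ k≤′t)) (n<1+n t))))

      -- Inside the segment c is never cut, so the haplotype above it stays c′
      -- and the counter of c counts exactly the segment ends of c′ inside it.
      overlap-≤ : ∀ {c c′ b t} → (b , suc t) ∈ refined c → above t c ≡ just c′ →
        length (filterᵇ (overlapsᵇ (b , suc t)) (refined c′)) ≤ suc δ
      overlap-≤ {b = zero} seg _ = contradiction (proj₁ (∈-intervalsFrom-bounds (breakpoints-ends _) seg)) λ ()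
      overlap-≤ {c} {c′} {suc a} {t} seg above≡c′ = begin
        length (filterᵇ (overlapsᵇ (suc a , suc t)) (refined c′))
          ≤⟨ overlapping-segments (λ k → cut k c′) (suc a) t<m ⟩
        suc (∑[ k < t ] 𝟙 ((suc a ≤ᵇ suc (toℕ k)) ∧ cut (toℕ k) c′))
          ≡⟨ cong suc (counter-window quiet (refined-counter-start seg) (≤⇒≤′ a≤t)) ⟨
        suc (counter t c)                                               ≤⟨ s≤s (counter-≤ t c) ⟩
        suc δ                                                           ∎
        where
        open ≤-Reasoning
        bounds = ∈-intervalsFrom-bounds (breakpoints-ends _) seg
        a≤t : a ≤ t
        a≤t = ≤-pred (proj₁ (proj₂ bounds))
        t<m : t < m
        t<m = proj₂ (proj₂ bounds)
        quiet : ∀ k → a ≤ k → k < t → cut k c ≡ false × above k c ≡ just c′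
        quiet k a≤k k<t = refined-uncut seg k a≤k k<t ,
          trans (above-constant t<m (λ k a≤k k<t → uncut⇒¬top (refined-uncut seg k a≤k k<t)) a≤k (≤⇒≤′ (<⇒≤ k<t)))
                above≡c′

-- Columns are indexed by ℕ; past the last column every haplotype is a run-top
-- with no haplotype above it.
module PanelColumns {h m : ℕ} (S : Panel h m) where
  open Colex S

  column : ℕ → Maybe (Fin m)
  column k with k <? m
  ... | yes k<m = just (fromℕ< k<m)
  ... | no  _   = nothing

  column-toℕ : ∀ j → column (toℕ j) ≡ just j
  column-toℕ j with toℕ j <? m
  ... | yes j<m = cong just (fromℕ<-toℕ j j<m)
  ... | no  j≮m = contradiction (toℕ<n j) j≮m

  column-< : ∀ {k} (k<m : k < m) → column k ≡ just (fromℕ< k<m)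
  column-< {k} k<m with k <? m
  ... | yes _   = refl
  ... | no  k≮m = contradiction k<m k≮m

  topAt : ℕ → Fin h → Bool
  topAt k c = maybe′ (λ j → runTop S j c) true (column k)

  aboveAt : ℕ → Fin h → Maybe (Fin h)
  aboveAt k c = maybe′ (λ j → φ S j c) nothing (column k)

  rankAt : ℕ → Fin h → ℕ
  rankAt k c = maybe′ (λ j → rank S j c) 0 (column k)

  topAt-toℕ : ∀ j c → topAt (toℕ j) c ≡ runTop S j c
  topAt-toℕ j c rewrite column-toℕ j = refl

  aboveAt-toℕ : ∀ j c → aboveAt (toℕ j) c ≡ φ S j c
  aboveAt-toℕ j c rewrite column-toℕ j = refl

  rankAt-aboveAt : ∀ {k c c′} → aboveAt k c ≡ just c′ → rankAt k c ≡ suc (rankAt k c′)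
  rankAt-aboveAt {k} with column k
  ... | just j = φ-rank

  aboveAt-injective : ∀ {k c₁ c₂ c′} → aboveAt k c₁ ≡ just c′ → aboveAt k c₂ ≡ just c′ → c₁ ≡ c₂
  aboveAt-injective {k} with column k
  ... | just j = φ-injective

  aboveAt-stable : ∀ {k c} → suc k < m → topAt k c ≡ false → aboveAt (suc k) c ≡ aboveAt k c
  aboveAt-stable {k} 1+k<m rewrite column-< 1+k<m | column-< (<-trans (n<1+n k) 1+k<m) =
    φ-stable (trans (toℕ-fromℕ< 1+k<m) (cong suc (sym (toℕ-fromℕ< (<-trans (n<1+n k) 1+k<m)))))

  runs≡∑-topAt : runs S ≡ ∑[ k < m ] ∑[ c < h ] 𝟙 (topAt (toℕ k) c)
  runs≡∑-topAt = begin
    runs S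
      ≡⟨ sum-map-allFin (λ j → length (filterᵇ (runTop S j) (allFin h))) ⟩
    ∑[ j < m ] length (filterᵇ (runTop S j) (allFin h))
      ≡⟨ sum-cong-≗ {m} (λ j → length-filterᵇ-allFin (runTop S j)) ⟩
    ∑[ j < m ] ∑[ c < h ] 𝟙 (runTop S j c)
      ≡⟨ sum-cong-≗ {m} (λ j → sum-cong-≗ {h} (λ c → cong 𝟙 (sym (topAt-toℕ j c)))) ⟩
    ∑[ k < m ] ∑[ c < h ] 𝟙 (topAt (toℕ k) c) ∎
    where open ≡-Reasoning

theorem14 : ∀ {h m : ℕ} (S : Panel h m) (d : ℕ) (d>1 : 1 < d) →
    Σ (Fin h → List Interval) λ RS →
      (∀ c → All (λ s → Any (λ t → s ⊆ᵢ t) (hapIntervals S c)) (RS c))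
      × (∀ c → IsPartition m (RS c))
      × (∀ c c' b e (j : Fin m) → (b , e) ∈ RS c → suc (toℕ j) ≡ e → φ S j c ≡ just c' →
           length (filterᵇ (overlapsᵇ (b , e)) (RS c')) ≤ d)
      × (sum (map (λ c → length (RS c)) (allFin h))
           ≤ runs S + h + ceilDiv (runs S + h) (d ∸ 1) {{>-nonZero (m<n⇒0<n∸m d>1)}})
theorem14 {h} {m} S (suc δ) (s≤s 1≤δ) =
  refined , refines , (λ c → segments-partition _) , bounded-overlaps , count
  where
  instance
    δ-nonZero : NonZero δ
    δ-nonZero = >-nonZero 1≤δ
  open PanelColumns S
  open Refinement topAt aboveAt rankAt δ
  refines : ∀ c → All (λ s → Any (s ⊆ᵢ_) (hapIntervals S c)) (refined c)
  refines c = segments-refine λ j → top⇒cut ∘ trans (topAt-toℕ j c)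
  bounded-overlaps : ∀ c c′ b e (j : Fin m) → (b , e) ∈ refined c → suc (toℕ j) ≡ e → φ S j c ≡ just c′ →
    length (filterᵇ (overlapsᵇ (b , e)) (refined c′)) ≤ suc δ
  bounded-overlaps c c′ b e j seg refl φ≡c′ =
    overlap-≤ rankAt-aboveAt aboveAt-stable seg (trans (aboveAt-toℕ j c) φ≡c′)
  count : sum (map (λ c → length (refined c)) (allFin h)) ≤ runs S + h + ceilDiv (runs S + h) δ
  count rewrite sum-map-allFin (λ c → length (refined c)) | runs≡∑-topAt = begin
    ∑[ c < h ] length (refined c)    ≤⟨ ∑-length-refined rankAt-aboveAt aboveAt-injective ⟩
    h + (Tops + Forced)              ≡⟨ trans (x∙yz≈y∙xz h Tops Forced) (sym (+-assoc Tops h Forced)) ⟩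
    Tops + h + Forced                ≤⟨ +-monoʳ-≤ (Tops + h) (≤-ceilDiv δ
                                          (≤-trans (forced-≤ rankAt-aboveAt aboveAt-injective) (m≤m+n Tops h))) ⟩
    Tops + h + ceilDiv (Tops + h) δ  ∎
    where open ≤-Reasoning
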